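{- Let $n\ge 7$ and let $\pi\in S_n$ be a leader permutation. For any permutations $\tau,\sigma\in S_n$ that are both adjacent to $\pi$, $\tau$ can be reached from $\sigma$ by a finite sequence of $\{1234,3412\}$-pattern-replacements.
   Context: Permutations are written in one-line notation; entries are called letters. A leader permutation of length $n$ is a permutation $a_1a_2\cdots a_n\in S_n$ such that for some integer $k\in[2,n]$, $a_i=k-i$ for all $1\le i<k$ and $a_i=n+k-i$ for all $k\le i\le n$. Two permutations $\pi,\rho\in S_n$ are adjacent if neither begins with $n$ or ends with $1$, and $\pi$ is obtained from $\rho$ by swapping the positions of two letters $x,y$ with $|x-y|\notin\{1,n-1\}$. A $\{1234,3412\}$-pattern-replacement on a permutation $\sigma$ takes positions $i_1<i_2<i_3<i_4$ such that $\sigma_{i_1}<\sigma_{i_2}<\sigma_{i_3}<\sigma_{i_4}$ (pattern $1234$) or $\sigma_{i_3}<\sigma_{i_4}<\sigma_{i_1}<\sigma_{i_2}$ (pattern $3412$), and swaps the letters in positions $i_1,i_3$ and in positions $i_2,i_4$. -}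

module Defs where

open import Data.Nat using (ℕ; suc; _+_; _∸_; _<_; _≤_)
open import Data.Fin using (Fin; toℕ)
open import Data.Fin.Permutation using (Permutation′; _⟨$⟩ʳ_; transpose)
open import Data.Product using (Σ; ∃; _×_)
open import Data.Sum using (_⊎_)
open import Relation.Binary.PropositionalEquality using (_≡_; _≢_)
open import Relation.Binary.Construct.Closure.ReflexiveTransitive using (Star)

-- One-line notation: the entry in (1-indexed) position  pos p = 1 + toℕ p  is the letter
-- let (π ⟨$⟩ʳ p) = 1 + toℕ (π ⟨$⟩ʳ p), a value in {1,…,n}.

pos : ∀ {n} → Fin n → ℕ
pos p = suc (toℕ p)

let′ : ∀ {n} → Fin n → ℕ
let′ x = suc (toℕ x)

_at_ : ∀ {n} → Permutation′ n → Fin n → ℕ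
π at p = let′ (π ⟨$⟩ʳ p)

Leader : ∀ n → Permutation′ n → Set
Leader n π = Σ ℕ λ k → (2 ≤ k) × (k ≤ n) ×
  ((p : Fin n) → (pos p < k → π at p ≡ k ∸ pos p) × (k ≤ pos p → π at p ≡ (n + k) ∸ pos p))

NotBeginNNotEnd1 : ∀ n → Permutation′ n → Set
NotBeginNNotEnd1 n π = ((p : Fin n) → pos p ≡ 1 → π at p ≢ n)
                     × ((p : Fin n) → pos p ≡ n → π at p ≢ 1)

-- Adjacency: neither begins with n nor ends with 1, and π is obtained from ρ by swapping
-- the positions of two (distinct) letters x, y with |x − y| ∉ {1, n−1}.
Adjacent : ∀ n → Permutation′ n → Permutation′ n → Set
Adjacent n π ρ = NotBeginNNotEnd1 n π × NotBeginNNotEnd1 n ρ ×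
  Σ (Fin n) λ x → Σ (Fin n) λ y →
    (x ≢ y) ×
    (suc (toℕ x) ≢ toℕ y) × (suc (toℕ y) ≢ toℕ x) ×
    (toℕ x + (n ∸ 1) ≢ toℕ y) × (toℕ y + (n ∸ 1) ≢ toℕ x) ×
    ((p : Fin n) → π ⟨$⟩ʳ p ≡ transpose x y ⟨$⟩ʳ (ρ ⟨$⟩ʳ p))

PatternReplacement : ∀ n → Permutation′ n → Permutation′ n → Set
PatternReplacement n σ σ′ =
  Σ (Fin n) λ i1 → Σ (Fin n) λ i2 → Σ (Fin n) λ i3 → Σ (Fin n) λ i4 →
    (toℕ i1 < toℕ i2) × (toℕ i2 < toℕ i3) × (toℕ i3 < toℕ i4) ×
    (   ((σ at i1 < σ at i2) × (σ at i2 < σ at i3) × (σ at i3 < σ at i4))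
      ⊎ ((σ at i3 < σ at i4) × (σ at i4 < σ at i1) × (σ at i1 < σ at i2)) ) ×
    ((p : Fin n) → σ′ ⟨$⟩ʳ p ≡ σ ⟨$⟩ʳ (transpose i1 i3 ⟨$⟩ʳ (transpose i2 i4 ⟨$⟩ʳ p)))

Reachable : ∀ n → Permutation′ n → Permutation′ n → Set
Reachable n = Star (PatternReplacement n)

{-# OPTIONS --safe #-}
-- Write ⟨ u , w ⟩ for π with the (0-indexed) letters u and w swapped.  If the letters a, b, c, d
-- occur in this order in π and c b a d is a 1234 or 3412 pattern, one replacement turns
-- ⟨ a , c ⟩ into ⟨ b , d ⟩, and replacements are reversible.  A leader permutation of length
-- m + 1 reads K−1 … 0 m … K, two decreasing blocks, so such quadruples abound (a, b, c < K ≤ d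
-- or a < K ≤ d, c, b).  They join every adjacent permutation to a fixed hub in at most three
-- steps: ⟨ K , m ⟩ if the high block has at least three letters, ⟨ 0 , K − 1 ⟩ otherwise.
module Submission where

open import Defs
open import Data.Nat
  using (ℕ; suc; pred; _+_; _∸_; _<_; _≤_; _<?_; _≤?_; z≤n; s≤s; s≤s⁻¹; >-nonZero)
open import Data.Nat.Properties
  using ( ≤-refl; ≤-reflexive; ≤-trans; ≤-antisym; <-trans; <-≤-trans; <⇒≤; <⇒≱; <-irrefl
        ; ≮⇒≥; ≰⇒>; ≤∧≢⇒<; n<1+n; n≤1+n; n≢0⇒n>0; suc-injective; m≤m+n; m≤n+m
        ; +-comm; +-suc; +-monoˡ-≤; +-monoʳ-≤; +-mono-<-≤; +-cancelˡ-≤; m∸n+n≡m; m+n∸m≡n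
        ; suc-pred; pred-mono-≤; suc[m]≤n⇒m≤pred[n]; module ≤-Reasoning)
  renaming (_≟_ to _≟ℕ_)
open import Data.Nat.DivMod using (_mod_; m<n⇒m%n≡m)
open import Data.Fin using (Fin; toℕ; fromℕ; _≟_) renaming (zero to fzero)
open import Data.Fin.Properties using (toℕ-fromℕ<; toℕ-fromℕ; toℕ-injective; toℕ<n; <⇒≢; <-cmp)
open import Data.Fin.Permutation
  using (Permutation′; _⟨$⟩ʳ_; _⟨$⟩ˡ_; _∘ₚ_; transpose; inverseˡ; inverseʳ; _≈_)
import Data.Fin.Permutation.Components as PC
open import Data.Product using (∃₂; _×_; _,_; proj₁; proj₂)
open import Data.Sum using (_⊎_; inj₁; inj₂)
import Data.Sum as Sum
open import Data.Empty using (⊥-elim)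
open import Function using (_∘′_)
open import Relation.Nullary using (¬_; Dec; yes; no)
open import Relation.Nullary.Decidable using (dec-true; dec-false)
open import Relation.Binary.Definitions using (tri<; tri≈; tri>)
open import Relation.Binary.PropositionalEquality
open import Relation.Binary.Construct.Closure.ReflexiveTransitive using (ε; _◅_; reverse)
open import Relation.Binary.Construct.Closure.ReflexiveTransitive.Properties
  using (module StarReasoning)

private variable
  n : ℕ

transpose-matchˡ : (i j : Fin n) → PC.transpose i j i ≡ j
transpose-matchˡ i j rewrite dec-true (i ≟ i) refl = refl

transpose-matchʳ : (i j : Fin n) → PC.transpose i j j ≡ i
transpose-matchʳ i j with j ≟ i
... | yes j≡i = j≡i
... | no _ rewrite dec-true (j ≟ j) refl = refl

transpose-mismatch : {i j k : Fin n} → k ≢ i → k ≢ j → PC.transpose i j k ≡ k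
transpose-mismatch {i = i} {j} {k} k≢i k≢j
  rewrite dec-false (k ≟ i) k≢i | dec-false (k ≟ j) k≢j = refl

transpose-sym : (i j k : Fin n) → PC.transpose i j k ≡ PC.transpose j i k
transpose-sym i j k = by-cases (k ≟ i) (k ≟ j)
  where
  by-cases : Dec (k ≡ i) → Dec (k ≡ j) → PC.transpose i j k ≡ PC.transpose j i k
  by-cases (yes refl) (yes refl) = refl
  by-cases (yes refl) (no _)     = trans (transpose-matchˡ k j) (sym (transpose-matchʳ j k))
  by-cases (no _)     (yes refl) = trans (transpose-matchʳ i k) (sym (transpose-matchˡ k i))
  by-cases (no k≢i)   (no k≢j)   =
    trans (transpose-mismatch k≢i k≢j) (sym (transpose-mismatch k≢j k≢i))

transpose-involutive : (i j k : Fin n) → PC.transpose i j (PC.transpose i j k) ≡ k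
transpose-involutive i j k =
  trans (cong (PC.transpose i j) (transpose-sym i j k)) (PC.transpose-inverse i j)

⟨$⟩ʳ-injective : (ρ : Permutation′ n) {i j : Fin n} → ρ ⟨$⟩ʳ i ≡ ρ ⟨$⟩ʳ j → i ≡ j
⟨$⟩ʳ-injective ρ {i} {j} ρi≡ρj =
  trans (sym (inverseˡ ρ)) (trans (cong (ρ ⟨$⟩ˡ_) ρi≡ρj) (inverseˡ ρ))

transpose-conjugate : (ρ : Permutation′ n) (i j k : Fin n) →
  ρ ⟨$⟩ʳ PC.transpose i j k ≡ PC.transpose (ρ ⟨$⟩ʳ i) (ρ ⟨$⟩ʳ j) (ρ ⟨$⟩ʳ k)
transpose-conjugate ρ i j k = by-cases (k ≟ i) (k ≟ j)
  where
  ρ⟨_⟩ = ρ ⟨$⟩ʳ_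
  by-cases : Dec (k ≡ i) → Dec (k ≡ j) →
             ρ⟨ PC.transpose i j k ⟩ ≡ PC.transpose ρ⟨ i ⟩ ρ⟨ j ⟩ ρ⟨ k ⟩
  by-cases (yes refl) _          =
    trans (cong ρ⟨_⟩ (transpose-matchˡ k j)) (sym (transpose-matchˡ ρ⟨ k ⟩ ρ⟨ j ⟩))
  by-cases (no _)     (yes refl) =
    trans (cong ρ⟨_⟩ (transpose-matchʳ i k)) (sym (transpose-matchʳ ρ⟨ i ⟩ ρ⟨ k ⟩))
  by-cases (no k≢i)   (no k≢j)   =
    trans (cong ρ⟨_⟩ (transpose-mismatch k≢i k≢j))
          (sym (transpose-mismatch (k≢i ∘′ ⟨$⟩ʳ-injective ρ) (k≢j ∘′ ⟨$⟩ʳ-injective ρ)))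

transpose-commute : {i j k l : Fin n} → i ≢ k → i ≢ l → j ≢ k → j ≢ l → (p : Fin n) →
  PC.transpose i j (PC.transpose k l p) ≡ PC.transpose k l (PC.transpose i j p)
transpose-commute {i = i} {j} {k} {l} i≢k i≢l j≢k j≢l p = begin
  PC.transpose i j (PC.transpose k l p)
    ≡⟨ cong₂ (λ i′ j′ → PC.transpose i′ j′ (PC.transpose k l p))
             (sym (transpose-mismatch i≢k i≢l)) (sym (transpose-mismatch j≢k j≢l)) ⟩
  PC.transpose (PC.transpose k l i) (PC.transpose k l j) (PC.transpose k l p)
    ≡⟨ sym (transpose-conjugate (transpose k l) i j p) ⟩
  PC.transpose k l (PC.transpose i j p) ∎
  where open ≡-Reasoning

Forms1234or3412 : ℕ → ℕ → ℕ → ℕ → Set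
Forms1234or3412 x₁ x₂ x₃ x₄ = (x₁ < x₂ × x₂ < x₃ × x₃ < x₄) ⊎ (x₃ < x₄ × x₄ < x₁ × x₁ < x₂)

Forms1234or3412-cong : ∀ {x₁ x₂ x₃ x₄ y₁ y₂ y₃ y₄} → x₁ ≡ y₁ → x₂ ≡ y₂ → x₃ ≡ y₃ → x₄ ≡ y₄ →
  Forms1234or3412 x₁ x₂ x₃ x₄ → Forms1234or3412 y₁ y₂ y₃ y₄
Forms1234or3412-cong refl refl refl refl shape = shape

-- The position swap is an involution exchanging the roles of 1234 and 3412.
PatternReplacement-sym : {σ σ′ : Permutation′ n} →
  PatternReplacement n σ σ′ → PatternReplacement n σ′ σ
PatternReplacement-sym {n} {σ} {σ′}
  (i₁ , i₂ , i₃ , i₄ , i₁<i₂ , i₂<i₃ , i₃<i₄ , shape , σ′≡σ∘swap) =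
  i₁ , i₂ , i₃ , i₄ , i₁<i₂ , i₂<i₃ , i₃<i₄ , shape′ , σ≡σ′∘swap
  where
  open ≡-Reasoning
  i₁<i₃ = <-trans i₁<i₂ i₂<i₃
  i₁<i₄ = <-trans i₁<i₃ i₃<i₄

  swap : Fin n → Fin n
  swap p = PC.transpose i₁ i₃ (PC.transpose i₂ i₄ p)

  swap-involutive : ∀ p → swap (swap p) ≡ p
  swap-involutive p = begin
    PC.transpose i₁ i₃ (PC.transpose i₂ i₄ (PC.transpose i₁ i₃ (PC.transpose i₂ i₄ p)))
      ≡⟨ cong (PC.transpose i₁ i₃)
              (transpose-commute (≢-sym (<⇒≢ i₁<i₂)) (<⇒≢ i₂<i₃) (≢-sym (<⇒≢ i₁<i₄))
                                 (≢-sym (<⇒≢ i₃<i₄)) (PC.transpose i₂ i₄ p)) ⟩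
    PC.transpose i₁ i₃ (PC.transpose i₁ i₃ (PC.transpose i₂ i₄ (PC.transpose i₂ i₄ p)))
      ≡⟨ transpose-involutive i₁ i₃ (PC.transpose i₂ i₄ (PC.transpose i₂ i₄ p)) ⟩
    PC.transpose i₂ i₄ (PC.transpose i₂ i₄ p)
      ≡⟨ transpose-involutive i₂ i₄ p ⟩
    p ∎

  letter : ∀ {p q} → swap p ≡ q → σ at q ≡ σ′ at p
  letter {p} refl = sym (cong let′ (σ′≡σ∘swap p))

  shape′ : Forms1234or3412 (σ′ at i₁) (σ′ at i₂) (σ′ at i₃) (σ′ at i₄)
  shape′ = Forms1234or3412-cong
    (letter (trans (cong (PC.transpose i₁ i₃) (transpose-mismatch (<⇒≢ i₁<i₂) (<⇒≢ i₁<i₄)))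
                   (transpose-matchˡ i₁ i₃)))
    (letter (trans (cong (PC.transpose i₁ i₃) (transpose-matchˡ i₂ i₄))
                   (transpose-mismatch (≢-sym (<⇒≢ i₁<i₄)) (≢-sym (<⇒≢ i₃<i₄)))))
    (letter (trans (cong (PC.transpose i₁ i₃) (transpose-mismatch (≢-sym (<⇒≢ i₂<i₃)) (<⇒≢ i₃<i₄)))
                   (transpose-matchʳ i₁ i₃)))
    (letter (trans (cong (PC.transpose i₁ i₃) (transpose-matchʳ i₂ i₄))
                   (transpose-mismatch (≢-sym (<⇒≢ i₁<i₂)) (<⇒≢ i₂<i₃))))
    (Sum.swap shape)

  σ≡σ′∘swap : ∀ p → σ ⟨$⟩ʳ p ≡ σ′ ⟨$⟩ʳ swap p
  σ≡σ′∘swap p = sym (trans (σ′≡σ∘swap (swap p)) (cong (σ ⟨$⟩ʳ_) (swap-involutive p)))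

PatternReplacement-resp : {σ σ′ τ τ′ : Permutation′ n} → σ ≈ τ → σ′ ≈ τ′ →
  PatternReplacement n σ σ′ → PatternReplacement n τ τ′
PatternReplacement-resp {σ = σ} {σ′} {τ} {τ′} σ≈τ σ′≈τ′
  (i₁ , i₂ , i₃ , i₄ , i₁<i₂ , i₂<i₃ , i₃<i₄ , shape , σ′≡σ∘swap) =
  i₁ , i₂ , i₃ , i₄ , i₁<i₂ , i₂<i₃ , i₃<i₄ ,
  Forms1234or3412-cong (letter i₁) (letter i₂) (letter i₃) (letter i₄) shape ,
  λ p → trans (sym (σ′≈τ′ p)) (trans (σ′≡σ∘swap p) (σ≈τ _))
  where
  letter : ∀ p → σ at p ≡ τ at p
  letter p = cong let′ (σ≈τ p)

-- Swapping the letters a and c of π makes the letters at the positions of a, b, c, d read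
-- c b a d, and replacing this occurrence yields π with b and d swapped instead.
transposition-replacement : (π : Permutation′ n) {a b c d : Fin n} →
  toℕ (π ⟨$⟩ˡ a) < toℕ (π ⟨$⟩ˡ b) → toℕ (π ⟨$⟩ˡ b) < toℕ (π ⟨$⟩ˡ c) →
  toℕ (π ⟨$⟩ˡ c) < toℕ (π ⟨$⟩ˡ d) → Forms1234or3412 (toℕ c) (toℕ b) (toℕ a) (toℕ d) →
  PatternReplacement n (π ∘ₚ transpose a c) (π ∘ₚ transpose b d)
transposition-replacement π {a} {b} {c} {d} a≺b b≺c c≺d shape =
  π ⟨$⟩ˡ a , π ⟨$⟩ˡ b , π ⟨$⟩ˡ c , π ⟨$⟩ˡ d , a≺b , b≺c , c≺d , shape′ , swapped
  where
  open ≡-Reasoning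
  σ = π ∘ₚ transpose a c

  b∉ac×d∉ac : (b ≢ a × b ≢ c) × (d ≢ a × d ≢ c)
  b∉ac×d∉ac = distinct shape
    where
    distinct : Forms1234or3412 (toℕ c) (toℕ b) (toℕ a) (toℕ d) → (b ≢ a × b ≢ c) × (d ≢ a × d ≢ c)
    distinct (inj₁ (c<b , b<a , a<d)) =
      (<⇒≢ b<a , ≢-sym (<⇒≢ c<b)) , (≢-sym (<⇒≢ a<d) , ≢-sym (<⇒≢ (<-trans c<b (<-trans b<a a<d))))
    distinct (inj₂ (a<d , d<c , c<b)) =
      (≢-sym (<⇒≢ (<-trans a<d (<-trans d<c c<b))) , ≢-sym (<⇒≢ c<b)) , (≢-sym (<⇒≢ a<d) , <⇒≢ d<c)

  letter : ∀ {v w} → PC.transpose a c v ≡ w → let′ w ≡ σ at (π ⟨$⟩ˡ v)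
  letter refl = sym (cong (let′ ∘′ PC.transpose a c) (inverseʳ π))

  shape′ : Forms1234or3412 (σ at (π ⟨$⟩ˡ a)) (σ at (π ⟨$⟩ˡ b)) (σ at (π ⟨$⟩ˡ c)) (σ at (π ⟨$⟩ˡ d))
  shape′ with (b≢a , b≢c) , (d≢a , d≢c) ← b∉ac×d∉ac =
    Forms1234or3412-cong
      (letter (transpose-matchˡ a c)) (letter (transpose-mismatch b≢a b≢c))
      (letter (transpose-matchʳ a c)) (letter (transpose-mismatch d≢a d≢c))
      (Sum.map s≤s³ s≤s³ shape)
    where
    s≤s³ : ∀ {x₁ y₁ x₂ y₂ x₃ y₃} → x₁ < y₁ × x₂ < y₂ × x₃ < y₃ →
           suc x₁ < suc y₁ × suc x₂ < suc y₂ × suc x₃ < suc y₃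
    s≤s³ (lt₁ , lt₂ , lt₃) = s≤s lt₁ , s≤s lt₂ , s≤s lt₃

  π-conjugate : ∀ u v q →
    π ⟨$⟩ʳ PC.transpose (π ⟨$⟩ˡ u) (π ⟨$⟩ˡ v) q ≡ PC.transpose u v (π ⟨$⟩ʳ q)
  π-conjugate u v q = trans (transpose-conjugate π (π ⟨$⟩ˡ u) (π ⟨$⟩ˡ v) q)
    (cong₂ (λ u′ v′ → PC.transpose u′ v′ (π ⟨$⟩ʳ q)) (inverseʳ π) (inverseʳ π))

  swapped : ∀ p → (π ∘ₚ transpose b d) ⟨$⟩ʳ p ≡
    σ ⟨$⟩ʳ PC.transpose (π ⟨$⟩ˡ a) (π ⟨$⟩ˡ c) (PC.transpose (π ⟨$⟩ˡ b) (π ⟨$⟩ˡ d) p)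
  swapped p = sym (begin
    PC.transpose a c (π ⟨$⟩ʳ PC.transpose (π ⟨$⟩ˡ a) (π ⟨$⟩ˡ c) (PC.transpose (π ⟨$⟩ˡ b) (π ⟨$⟩ˡ d) p))
      ≡⟨ cong (PC.transpose a c) (π-conjugate a c _) ⟩
    PC.transpose a c (PC.transpose a c (π ⟨$⟩ʳ PC.transpose (π ⟨$⟩ˡ b) (π ⟨$⟩ˡ d) p))
      ≡⟨ transpose-involutive a c _ ⟩
    π ⟨$⟩ʳ PC.transpose (π ⟨$⟩ˡ b) (π ⟨$⟩ˡ d) p
      ≡⟨ π-conjugate b d p ⟩
    PC.transpose b d (π ⟨$⟩ʳ p) ∎)

x+a≡y+b∧x<y⇒b<a : ∀ {x a y b} → x + a ≡ y + b → x < y → b < a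
x+a≡y+b∧x<y⇒b<a x+a≡y+b x<y = ≰⇒> λ a≤b → <-irrefl x+a≡y+b (+-mono-<-≤ x<y a≤b)

-- Up to ≈ (no function extensionality), a walk with at least one step can have its
-- endpoints replaced by pointwise equal permutations: the first and last steps absorb them.
◅-resp-≈ʳ : {ρ ρ′ τ τ′ : Permutation′ n} → τ ≈ τ′ →
  PatternReplacement n ρ ρ′ → Reachable n ρ′ τ → Reachable n ρ τ′
◅-resp-≈ʳ {ρ = ρ} {ρ′} {τ′ = τ′} τ≈τ′ step ε =
  PatternReplacement-resp {σ = ρ} {ρ′} {ρ} {τ′} (λ _ → refl) τ≈τ′ step ◅ ε
◅-resp-≈ʳ {ρ′ = ρ′} τ≈τ′ step (step′ ◅ rest) = _◅_ {j = ρ′} step (◅-resp-≈ʳ τ≈τ′ step′ rest)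

Reachable-resp-≈ : {σ σ′ ρ ρ′ τ τ′ : Permutation′ n} → σ ≈ σ′ → τ ≈ τ′ →
  Reachable n σ ρ → PatternReplacement n ρ ρ′ → Reachable n ρ′ τ → Reachable n σ′ τ′
Reachable-resp-≈ {σ = σ} {σ′} {ρ′ = ρ′} σ≈σ′ τ≈τ′ ε step rest =
  ◅-resp-≈ʳ τ≈τ′ (PatternReplacement-resp {σ = σ} {ρ′} {σ′} {ρ′} σ≈σ′ (λ _ → refl) step) rest
Reachable-resp-≈ {σ = σ} {σ′} σ≈σ′ τ≈τ′ (_◅_ {j = υ} first walk) step rest =
  _◅_ {j = υ} (PatternReplacement-resp {σ = σ} {υ} {σ′} {υ} σ≈σ′ (λ _ → refl) first)
    (Reachable-resp-≈ (λ _ → refl) τ≈τ′ walk step rest)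

-- The leader condition with n = m + 1 and k = K + 1.
module LeaderPermutation (m K : ℕ) (π : Permutation′ (suc m)) (1≤K : 1 ≤ K) (K≤m : K ≤ m)
  (leader : (p : Fin (suc m)) → (pos p < suc K → π at p ≡ suc K ∸ pos p)
                                × (suc K ≤ pos p → π at p ≡ (suc m + suc K) ∸ pos p)) where

  -- Letters are handled as naturals; val is only meaningful for v ≤ m.
  val : ℕ → Fin (suc m)
  val v = v mod suc m

  toℕ-val : ∀ {v} → v ≤ m → toℕ (val v) ≡ v
  toℕ-val v≤m = trans (toℕ-fromℕ< _) (m<n⇒m%n≡m (s≤s v≤m))

  val-toℕ : (x : Fin (suc m)) → val (toℕ x) ≡ x
  val-toℕ x = toℕ-injective (toℕ-val (s≤s⁻¹ (toℕ<n x)))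

  ⟨_,_⟩ : ℕ → ℕ → Permutation′ (suc m)
  ⟨ u , w ⟩ = π ∘ₚ transpose (val u) (val w)

  ⟨,⟩-comm : ∀ u w → ⟨ u , w ⟩ ≈ ⟨ w , u ⟩
  ⟨,⟩-comm u w p = transpose-sym (val u) (val w) (π ⟨$⟩ʳ p)

  position : ℕ → ℕ
  position v = toℕ (π ⟨$⟩ˡ val v)

  letter-at-position : ∀ {v} → v ≤ m → π at (π ⟨$⟩ˡ val v) ≡ suc v
  letter-at-position v≤m = cong suc (trans (cong toℕ (inverseʳ π)) (toℕ-val v≤m))

  position-sum : ∀ {v} → v ≤ m →
    (v < K × suc v + position v ≡ K) ⊎ (K ≤ v × suc v + position v ≡ m + suc K)
  position-sum {v} v≤m with position v <? K
  ... | yes p<K = inj₁ (subst (suc v ≤_) sum≡K (m≤m+n (suc v) (position v)) , sum≡K)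
    where
    sum≡K : suc v + position v ≡ K
    sum≡K = trans (cong (_+ position v) (trans (sym (letter-at-position v≤m))
                                               (proj₁ (leader (π ⟨$⟩ˡ val v)) (s≤s p<K))))
                  (m∸n+n≡m (<⇒≤ p<K))
  ... | no p≮K = inj₂ (s≤s⁻¹ (+-cancelˡ-≤ m _ _ (subst (_≤ m + suc v) sum≡ bound)) , sum≡)
    where
    p≤m : position v ≤ m
    p≤m = s≤s⁻¹ (toℕ<n (π ⟨$⟩ˡ val v))
    sum≡ : suc v + position v ≡ m + suc K
    sum≡ = trans (cong (_+ position v) (trans (sym (letter-at-position v≤m))
                                              (proj₂ (leader (π ⟨$⟩ˡ val v)) (s≤s (≮⇒≥ p≮K)))))
                 (m∸n+n≡m (≤-trans p≤m (m≤m+n m (suc K))))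
    bound : suc v + position v ≤ m + suc v
    bound = subst (suc v + position v ≤_) (+-comm (suc v) m) (+-monoʳ-≤ (suc v) p≤m)

  position-low : ∀ {v} → v < K → suc v + position v ≡ K
  position-low {v} v<K with position-sum (≤-trans (<⇒≤ v<K) K≤m)
  ... | inj₁ (_ , sum≡K) = sum≡K
  ... | inj₂ (K≤v , _)   = ⊥-elim (<⇒≱ v<K K≤v)

  position-high : ∀ {v} → K ≤ v → v ≤ m → suc v + position v ≡ m + suc K
  position-high {v} K≤v v≤m with position-sum v≤m
  ... | inj₁ (v<K , _) = ⊥-elim (<⇒≱ v<K K≤v)
  ... | inj₂ (_ , sum≡) = sum≡

  low-block-antitone : ∀ {u v} → u < v → v < K → position v < position u
  low-block-antitone u<v v<K =
    x+a≡y+b∧x<y⇒b<a (trans (position-low (<-trans u<v v<K)) (sym (position-low v<K))) (s≤s u<v)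

  high-block-antitone : ∀ {u v} → K ≤ u → u < v → v ≤ m → position v < position u
  high-block-antitone K≤u u<v v≤m =
    x+a≡y+b∧x<y⇒b<a (trans (position-high K≤u (≤-trans (<⇒≤ u<v) v≤m))
                           (sym (position-high (≤-trans K≤u (<⇒≤ u<v)) v≤m)))
                    (s≤s u<v)

  low-block-first : ∀ {u v} → u < K → K ≤ v → v ≤ m → position u < position v
  low-block-first {u} {v} u<K K≤v v≤m = <-≤-trans position-u<K K≤position-v
    where
    position-u<K : position u < K
    position-u<K = subst (position u <_) (position-low u<K) (s≤s (m≤n+m (position u) u))
    K≤position-v : K ≤ position v
    K≤position-v = s≤s⁻¹ (+-cancelˡ-≤ m _ _ (begin
      m + suc K              ≡⟨ sym (position-high K≤v v≤m) ⟩
      suc v + position v     ≤⟨ +-monoˡ-≤ (position v) (s≤s v≤m) ⟩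
      suc m + position v     ≡⟨ sym (+-suc m (position v)) ⟩
      m + suc (position v)   ∎))
      where open ≤-Reasoning

  _⟶_ : Permutation′ (suc m) → Permutation′ (suc m) → Set
  _⟶_ = PatternReplacement (suc m)

  low-edge : ∀ {a b c d} → c < b → b < a → a < K → K ≤ d → d ≤ m → ⟨ c , a ⟩ ⟶ ⟨ b , d ⟩
  low-edge {a} {b} {c} {d} c<b b<a a<K K≤d d≤m =
    PatternReplacement-resp {σ = ⟨ a , c ⟩} {⟨ b , d ⟩} {⟨ c , a ⟩} {⟨ b , d ⟩}
      (⟨,⟩-comm a c) (λ _ → refl)
      (transposition-replacement π {val a} {val b} {val c} {val d}
        (low-block-antitone b<a a<K) (low-block-antitone c<b b<K) (low-block-first c<K K≤d d≤m)
        (Forms1234or3412-cong (sym (toℕ-val (≤-trans (<⇒≤ c<K) K≤m)))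
                              (sym (toℕ-val (≤-trans (<⇒≤ b<K) K≤m)))
                              (sym (toℕ-val (≤-trans (<⇒≤ a<K) K≤m)))
                              (sym (toℕ-val d≤m))
                              (inj₁ (c<b , b<a , <-≤-trans a<K K≤d))))
    where
    b<K = <-trans b<a a<K
    c<K = <-trans c<b b<K

  high-edge : ∀ {a b c d} → a < K → K ≤ d → d < c → c < b → b ≤ m → ⟨ a , c ⟩ ⟶ ⟨ d , b ⟩
  high-edge {a} {b} {c} {d} a<K K≤d d<c c<b b≤m =
    PatternReplacement-resp {σ = ⟨ a , c ⟩} {⟨ b , d ⟩} {⟨ a , c ⟩} {⟨ d , b ⟩}
      (λ _ → refl) (⟨,⟩-comm b d)
      (transposition-replacement π {val a} {val b} {val c} {val d}
        (low-block-first a<K K≤b b≤m) (high-block-antitone K≤c c<b b≤m)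
        (high-block-antitone K≤d d<c c≤m)
        (Forms1234or3412-cong (sym (toℕ-val c≤m)) (sym (toℕ-val b≤m))
                              (sym (toℕ-val (≤-trans (<⇒≤ a<K) K≤m)))
                              (sym (toℕ-val (≤-trans (<⇒≤ d<c) c≤m)))
                              (inj₂ (<-≤-trans a<K K≤d , d<c , c<b))))
    where
    c≤m = ≤-trans (<⇒≤ c<b) b≤m
    K≤c = ≤-trans K≤d (<⇒≤ d<c)
    K≤b = ≤-trans K≤c (<⇒≤ c<b)

  -- The transposition (u w), u < w, turning π into an adjacent permutation.  Since π begins
  -- with K−1 and ends with K, the swaps (K−1 m) and (0 K) would put n first, resp. 1 last.
  record Admissible (u w : ℕ) : Set where
    field
      separated   : suc u < w
      bounded     : w ≤ m
      not-cyclic  : ¬ (u ≡ 0 × w ≡ m)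
      not-first-m : ¬ (suc u ≡ K × w ≡ m)
      not-last-0  : ¬ (u ≡ 0 × w ≡ K)

  low-interior : ∀ {u w} → Admissible u w → u < K → w ≡ K ⊎ w ≡ m → 0 < u × suc u < K
  low-interior adm u<K w≡K∨m =
    n≢0⇒n>0 (λ u≡0 → Sum.[ (λ w≡K → not-last-0 (u≡0 , w≡K))
                           , (λ w≡m → not-cyclic (u≡0 , w≡m)) ] w≡K∨m) ,
    ≤∧≢⇒< u<K (λ 1+u≡K → Sum.[ (λ w≡K → <-irrefl (trans 1+u≡K (sym w≡K)) separated)
                             , (λ w≡m → not-first-m (1+u≡K , w≡m)) ] w≡K∨m)
    where open Admissible adm

  first-letter : suc (toℕ (π ⟨$⟩ʳ fzero)) ≡ K
  first-letter = proj₁ (leader fzero) (s≤s 1≤K)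

  last-letter : toℕ (π ⟨$⟩ʳ fromℕ m) ≡ K
  last-letter = suc-injective (trans (proj₂ (leader (fromℕ m)) K+1≤pos)
    (trans (cong (λ p → m + suc K ∸ p) (toℕ-fromℕ m)) (m+n∸m≡n m (suc K))))
    where
    K+1≤pos : suc K ≤ pos (fromℕ m)
    K+1≤pos = subst (λ p → suc K ≤ suc p) (sym (toℕ-fromℕ m)) (s≤s K≤m)

  sorted-adjacent : ∀ {σ} (x y : Fin (suc m)) → toℕ x < toℕ y → suc (toℕ x) ≢ toℕ y →
    toℕ x + m ≢ toℕ y → NotBeginNNotEnd1 (suc m) σ →
    (∀ p → σ ⟨$⟩ʳ p ≡ PC.transpose x y (π ⟨$⟩ʳ p)) →
    Admissible (toℕ x) (toℕ y) × σ ≈ ⟨ toℕ x , toℕ y ⟩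
  sorted-adjacent {σ} x y x<y 1+x≢y x+m≢y (σ-first , σ-last) σ≡ = admissible , σ≈
    where
    open ≡-Reasoning
    σ≈ : σ ≈ ⟨ toℕ x , toℕ y ⟩
    σ≈ p = trans (σ≡ p)
      (cong₂ (λ a b → PC.transpose a b (π ⟨$⟩ʳ p)) (sym (val-toℕ x)) (sym (val-toℕ y)))

    admissible : Admissible (toℕ x) (toℕ y)
    admissible = record
      { separated   = ≤∧≢⇒< x<y 1+x≢y
      ; bounded     = s≤s⁻¹ (toℕ<n y)
      ; not-cyclic  = λ (x≡0 , y≡m) → x+m≢y (trans (cong (_+ m) x≡0) (sym y≡m))
      ; not-first-m = λ (1+x≡K , y≡m) → σ-first fzero refl (begin
          σ at fzero                              ≡⟨ cong let′ (σ≡ fzero) ⟩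
          let′ (PC.transpose x y (π ⟨$⟩ʳ fzero)) ≡⟨ cong (let′ ∘′ PC.transpose x y) (toℕ-injective
                                                       (suc-injective (trans first-letter (sym 1+x≡K)))) ⟩
          let′ (PC.transpose x y x)               ≡⟨ cong let′ (transpose-matchˡ x y) ⟩
          suc (toℕ y)                             ≡⟨ cong suc y≡m ⟩
          suc m                                   ∎)
      ; not-last-0  = λ (x≡0 , y≡K) → σ-last (fromℕ m) (cong suc (toℕ-fromℕ m)) (begin
          σ at fromℕ m                              ≡⟨ cong let′ (σ≡ (fromℕ m)) ⟩
          let′ (PC.transpose x y (π ⟨$⟩ʳ fromℕ m)) ≡⟨ cong (let′ ∘′ PC.transpose x y)
                                                         (toℕ-injective (trans last-letter (sym y≡K))) ⟩
          let′ (PC.transpose x y y)                 ≡⟨ cong let′ (transpose-matchʳ x y) ⟩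
          suc (toℕ x)                               ≡⟨ cong suc x≡0 ⟩
          1                                         ∎)
      }

  adjacent-vertex : ∀ {σ} → Adjacent (suc m) σ π → ∃₂ λ u w → Admissible u w × σ ≈ ⟨ u , w ⟩
  adjacent-vertex {σ} (σ-ends , _ , x , y , x≢y , 1+x≢y , 1+y≢x , x+m≢y , y+m≢x , σ≡)
    with <-cmp x y
  ... | tri< x<y _ _ = toℕ x , toℕ y , sorted-adjacent {σ} x y x<y 1+x≢y x+m≢y σ-ends σ≡
  ... | tri≈ _ x≡y _ = ⊥-elim (x≢y x≡y)
  ... | tri> _ _ y<x = toℕ y , toℕ x , sorted-adjacent {σ} y x y<x 1+y≢x y+m≢x σ-ends
                                 (λ p → trans (σ≡ p) (transpose-sym x y (π ⟨$⟩ʳ p)))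

  -- The excursion hub ⟶ hub′ ⟶ hub only makes the walk nonempty, as Reachable-resp-≈ requires.
  connected-through : (hub hub′ : Permutation′ (suc m)) → hub ⟶ hub′ →
    (∀ {u w} → Admissible u w → Reachable (suc m) ⟨ u , w ⟩ hub) →
    ∀ {σ τ} → Adjacent (suc m) σ π → Adjacent (suc m) τ π → Reachable (suc m) σ τ
  connected-through hub hub′ hub⟶hub′ reaches-hub {σ} {τ} σ∼π τ∼π
    with u  , w  , σ-adm , σ≈ ← adjacent-vertex {σ} σ∼π
       | u′ , w′ , τ-adm , τ≈ ← adjacent-vertex {τ} τ∼π =
    Reachable-resp-≈ {σ = ⟨ u , w ⟩} {σ} {hub} {hub′} {⟨ u′ , w′ ⟩} {τ}
      (λ p → sym (σ≈ p)) (λ p → sym (τ≈ p)) (reaches-hub σ-adm) hub⟶hub′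
      (_◅_ {j = hub} (PatternReplacement-sym {σ = hub} {hub′} hub⟶hub′)
        (reverse (λ {σ} {σ′} → PatternReplacement-sym {σ = σ} {σ′}) (reaches-hub τ-adm)))

  module HighBlockOfAtLeastThree (K+2≤m : suc (suc K) ≤ m) where

    hub : Permutation′ (suc m)
    hub = ⟨ K , m ⟩

    to-hub : ∀ {u w} → u < K → K < w → w < m → ⟨ u , w ⟩ ⟶ hub
    to-hub u<K K<w w<m = high-edge u<K ≤-refl K<w w<m ≤-refl

    loop : hub ⟶ ⟨ 0 , suc K ⟩
    loop = PatternReplacement-sym {σ = ⟨ 0 , suc K ⟩} {hub} (to-hub 1≤K (n<1+n K) K+2≤m)

    detour : ∀ {u w} → Admissible u w → u < K → K ≤ w → w ≡ K ⊎ w ≡ m →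
             Reachable (suc m) ⟨ u , w ⟩ hub
    detour adm u<K K≤w w≡K∨m with low-interior adm u<K w≡K∨m
    detour {suc v} {w} adm _ K≤w _ | _ , u+1<K = begin
      ⟨ suc v , w ⟩       ⟶⟨ PatternReplacement-sym {σ = ⟨ v , suc (suc v) ⟩} {⟨ suc v , w ⟩}
                               (low-edge (n<1+n v) (n<1+n (suc v)) u+1<K K≤w
                                         (Admissible.bounded adm)) ⟩
      ⟨ v , suc (suc v) ⟩ ⟶⟨ low-edge (n<1+n v) (n<1+n (suc v)) u+1<K (n≤1+n K) (<⇒≤ K+2≤m) ⟩
      ⟨ suc v , suc K ⟩   ⟶⟨ to-hub (<-trans (n<1+n (suc v)) u+1<K) (n<1+n K) K+2≤m ⟩
      hub                 ∎
      where open StarReasoning _⟶_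

    reaches-hub : ∀ {u w} → Admissible u w → Reachable (suc m) ⟨ u , w ⟩ hub
    reaches-hub {u} {w} adm with w <? K | u <? K
    ... | yes w<K | _ = begin
      ⟨ u , w ⟩         ⟶⟨ low-edge (n<1+n u) separated w<K (n≤1+n K) (<⇒≤ K+2≤m) ⟩
      ⟨ suc u , suc K ⟩ ⟶⟨ to-hub (<-trans separated w<K) (n<1+n K) K+2≤m ⟩
      hub               ∎
      where open StarReasoning _⟶_
            open Admissible adm
    ... | no _   | no u≮K = begin
      ⟨ u , w ⟩     ⟶⟨ PatternReplacement-sym {σ = ⟨ 0 , suc u ⟩} {⟨ u , w ⟩}
                         (high-edge 1≤K (≮⇒≥ u≮K) (n<1+n u) separated bounded) ⟩
      ⟨ 0 , suc u ⟩ ⟶⟨ to-hub 1≤K (s≤s (≮⇒≥ u≮K)) (<-≤-trans separated bounded) ⟩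
      hub           ∎
      where open StarReasoning _⟶_
            open Admissible adm
    ... | no w≮K | yes u<K with K <? w | w <? m
    ...   | yes K<w | yes w<m = to-hub u<K K<w w<m ◅ ε
    ...   | no K≮w  | _       = detour adm u<K (≮⇒≥ w≮K) (inj₁ (≤-antisym (≮⇒≥ K≮w) (≮⇒≥ w≮K)))
    ...   | yes _   | no w≮m  =
      detour adm u<K (≮⇒≥ w≮K) (inj₂ (≤-antisym (Admissible.bounded adm) (≮⇒≥ w≮m)))

  module HighBlockOfAtMostTwo (3≤K : 3 ≤ K) (m≤K+1 : m ≤ suc K) where

    j : ℕ
    j = pred K

    j<K : j < K
    j<K = ≤-reflexive (suc-pred K {{>-nonZero 1≤K}})

    hub : Permutation′ (suc m)
    hub = ⟨ 0 , j ⟩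

    from-hub : ∀ {b e} → 0 < b → b < j → K ≤ e → e ≤ m → hub ⟶ ⟨ b , e ⟩
    from-hub 0<b b<j = low-edge 0<b b<j j<K

    loop : hub ⟶ ⟨ 1 , K ⟩
    loop = from-hub (s≤s z≤n) (pred-mono-≤ 3≤K) ≤-refl K≤m

    reaches-hub : ∀ {u w} → Admissible u w → Reachable (suc m) ⟨ u , w ⟩ hub
    reaches-hub {u} {w} adm with w <? K | u <? K
    ... | yes w<K | _ = begin
      ⟨ u , w ⟩     ⟶⟨ low-edge (n<1+n u) separated w<K K≤m ≤-refl ⟩
      ⟨ suc u , m ⟩ ⟶⟨ PatternReplacement-sym {σ = hub} {⟨ suc u , m ⟩}
                         (from-hub (s≤s z≤n) (<-≤-trans separated (suc[m]≤n⇒m≤pred[n] w<K))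
                                   K≤m ≤-refl) ⟩
      hub           ∎
      where open StarReasoning _⟶_
            open Admissible adm
    ... | no w≮K | yes u<K = PatternReplacement-sym {σ = hub} {⟨ u , w ⟩}
                               (from-hub 0<u (suc[m]≤n⇒m≤pred[n] u+1<K) (≮⇒≥ w≮K) bounded) ◅ ε
      where
      open Admissible adm
      w≡K∨m : w ≡ K ⊎ w ≡ m
      w≡K∨m with w ≟ℕ K
      ... | yes w≡K = inj₁ w≡K
      ... | no w≢K  = inj₂ (≤-antisym bounded (≤-trans m≤K+1 (≤∧≢⇒< (≮⇒≥ w≮K) (≢-sym w≢K))))
      0<u×u+1<K = low-interior adm u<K w≡K∨m
      0<u = proj₁ 0<u×u+1<K
      u+1<K = proj₂ 0<u×u+1<K
    ... | no _ | no u≮K = ⊥-elim (<-irrefl refl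
      (<-≤-trans separated (≤-trans bounded (≤-trans m≤K+1 (s≤s (≮⇒≥ u≮K))))))
      where open Admissible adm

  adjacent-connected : 4 ≤ m → ∀ {σ τ} → Adjacent (suc m) σ π → Adjacent (suc m) τ π →
                       Reachable (suc m) σ τ
  adjacent-connected 4≤m with suc (suc K) ≤? m
  ... | yes K+2≤m = connected-through hub ⟨ 0 , suc K ⟩ loop reaches-hub
    where open HighBlockOfAtLeastThree K+2≤m
  ... | no K+2≰m  = connected-through hub ⟨ 1 , K ⟩ loop reaches-hub
    where
    m≤K+1 : m ≤ suc K
    m≤K+1 = s≤s⁻¹ (≰⇒> K+2≰m)
    open HighBlockOfAtMostTwo (s≤s⁻¹ (≤-trans 4≤m m≤K+1)) m≤K+1

lemma16 : (n : ℕ) → 7 ≤ n → (π : Permutation′ n) → Leader n π →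
          (τ σ : Permutation′ n) → Adjacent n τ π → Adjacent n σ π →
          Reachable n σ τ
lemma16 (suc m) (s≤s 6≤m) π (suc K , s≤s 1≤K , k≤n , leader) τ σ τ∼π σ∼π =
  adjacent-connected (≤-trans (m≤n+m 4 2) 6≤m) σ∼π τ∼π
  where open LeaderPermutation m K π 1≤K (s≤s⁻¹ k≤n) leader
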